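{- For every fixed positive integer $r$, $\chi_{CF}(\mathsf{D}_r^2(n))=\Theta(n^{1/r})$ as $n\to\infty$.
   Context: A conflict-free coloring (CF-coloring) of a hypergraph $(V,\mathcal{E})$ is a map $\varphi$ on $V$ such that every nonempty hyperedge $e$ contains a vertex $x$ with $\varphi(y)\ne\varphi(x)$ for all $y\in e\setminus\{x\}$; $\chi_{CF}(H)$ is the least number of colors in a CF-coloring of $H$. $C_{[n]}$ is the cycle on vertex set $[n]$ with edges $\{i,i+1\}$ (indices mod $n$). $\mathsf{D}_r^2(n)$ is the $2r$-uniform hypergraph on $[n]$ whose hyperedges are the sets $V(P_1)\cup V(P_2)$ where $P_1,P_2$ are vertex-disjoint paths on $r$ vertices in $C_{[n]}$. -}

module Defs where

open import Data.Nat using (ℕ; _+_; _<_)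
open import Data.Fin using (Fin; toℕ)
open import Data.Product using (Σ; ∃-syntax; _×_)
open import Data.Sum using (_⊎_)
open import Data.Empty using (⊥)
open import Relation.Binary.PropositionalEquality using (_≡_; _≢_)

record Hypergraph (V : Set) : Set₁ where
  field
    Edge : Set
    _∈ₑ_ : V → Edge → Set
open Hypergraph public

IsCFColoring : {V C : Set} (H : Hypergraph V) → (V → C) → Set
IsCFColoring {V} H φ =
  (e : Edge H) → ∃[ z ] (_∈ₑ_ H z e) →
  ∃[ x ] (_∈ₑ_ H x e × ((y : V) → _∈ₑ_ H y e → y ≢ x → φ y ≢ φ x))

-- H admits a CF-colouring with (at most) k colours, i.e. χ_CF(H) ≤ k.
CFColorable : {V : Set} → Hypergraph V → ℕ → Set
CFColorable {V} H k = Σ (V → Fin k) (IsCFColoring H)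

-- The cycle C_[n] has vertices 0,…,n-1 (representing [n]) and edges {i,i+1 mod n}.
-- A path on r vertices in C_[n] is an arc {i, i+1, …, i+r-1} (mod n).
-- OnArc n r i v : vertex v lies on the arc of r consecutive vertices starting at i.
-- (Since i < n, i + j for j < r ≤ n is congruent to v mod n iff i+j = v or i+j = v+n.)
OnArc : (n r : ℕ) → Fin n → Fin n → Set
OnArc n r i v = ∃[ j ] (j < r × (toℕ i + j ≡ toℕ v ⊎ toℕ i + j ≡ toℕ v + n))

DisjointArcs : (n r : ℕ) → Fin n → Fin n → Set
DisjointArcs n r i₁ i₂ = (v : Fin n) → OnArc n r i₁ v → OnArc n r i₂ v → ⊥

-- D_r^2(n): hyperedges are V(P₁) ∪ V(P₂) for vertex-disjoint paths P₁, P₂ on r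
-- vertices in C_[n].
D2 : (r n : ℕ) → Hypergraph (Fin n)
D2 r n = record
  { Edge = Σ (Fin n × Fin n) (λ p → DisjointArcs n r (Data.Product.proj₁ p) (Data.Product.proj₂ p))
  ; _∈ₑ_ = λ v e → OnArc n r (Data.Product.proj₁ (Data.Product.proj₁ e)) v
                 ⊎ OnArc n r (Data.Product.proj₂ (Data.Product.proj₁ e)) v
  }

module Submission where

-- Lower bound: cut the cycle into k^r + 1 disjoint arcs of r vertices.  Two of them carry
-- the same colour sequence, and in the hyperedge they form every colour occurs twice.
--
-- Upper bound: pick q with q^r ≥ n and q = O(n^(1/r)).  A vertex v sits at position
-- s = v mod 2r of block ⌊v/2r⌋; colour it by s together with the digit of index s mod r
-- of the block number in base q, and give the last 2r vertices private colours, so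
-- O(r q) colours are used.  An arc of r consecutive vertices sees r consecutive
-- positions and hence every digit of its block (across a block boundary the high digits
-- of m and the low digits of m + 1, which still determine m).  So if every colour of one
-- arc reappeared on a second arc, the two arcs would start at the same position of the
-- same block and coincide; hence for disjoint arcs some colour of the first arc is
-- missing from the second, and it is unique in the hyperedge because positions on one
-- arc are distinct.

open import Data.Empty using (⊥-elim)
open import Data.Fin using (Fin; toℕ; fromℕ<; funToFin; finToFun)
open import Data.Fin.Properties
  using (toℕ<n; toℕ-fromℕ<; toℕ-injective; fromℕ<-cong; pigeonhole; finToFun-funToFin)
open import Data.Nat
open import Data.Nat.DivMod
open import Data.Nat.Properties
open import Data.Nat.Tactic.RingSolver using (solve-∀)
open import Data.Product
open import Data.Sum using (inj₁; inj₂)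
open import Relation.Binary.PropositionalEquality
open import Relation.Nullary using (¬_; Dec; yes; no; ¬?)
open import Relation.Nullary.Decidable using (decidable-stable)

open import Defs

-- Residues

%-/-unique : ∀ {d x a b} .{{_ : NonZero d}} → a < d → x ≡ a + b * d → x % d ≡ a × x / d ≡ b
%-/-unique {d} {x} {a} {b} a<d refl = x%d≡a , x/d≡b
  where
  x%d≡a : x % d ≡ a
  x%d≡a = trans ([m+kn]%n≡m%n a b d) (m<n⇒m%n≡m a<d)
  x/d≡b : x / d ≡ b
  x/d≡b = *-cancelʳ-≡ (x / d) b d (+-cancelˡ-≡ a _ _ (begin
    a + x / d * d     ≡⟨ cong (_+ x / d * d) x%d≡a ⟨
    x % d + x / d * d ≡⟨ m≡m%n+[m/n]*n x d ⟨
    a + b * d         ∎))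
    where open ≡-Reasoning

+-*-injective : ∀ {d a a′ b b′} .{{_ : NonZero d}} → a < d → a′ < d →
                a + b * d ≡ a′ + b′ * d → a ≡ a′ × b ≡ b′
+-*-injective a<d a′<d eq with %-/-unique a<d refl | %-/-unique a′<d eq
... | %≡a , /≡b | %≡a′ , /≡b′ = trans (sym %≡a) %≡a′ , trans (sym /≡b) /≡b′

≡-by-%-/ : ∀ {d x y} .{{_ : NonZero d}} → x % d ≡ y % d → x / d ≡ y / d → x ≡ y
≡-by-%-/ {d} {x} {y} %≡ /≡ = begin
  x                 ≡⟨ m≡m%n+[m/n]*n x d ⟩
  x % d + x / d * d ≡⟨ cong₂ (λ a b → a + b * d) %≡ /≡ ⟩
  y % d + y / d * d ≡⟨ m≡m%n+[m/n]*n y d ⟨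
  y                 ∎
  where open ≡-Reasoning

%-cong-+ʳ : ∀ {d x y} s .{{_ : NonZero d}} → x % d ≡ y % d → (x + s) % d ≡ (y + s) % d
%-cong-+ʳ {d} {x} {y} s eq = begin
  (x + s) % d             ≡⟨ %-distribˡ-+ x s d ⟩
  (x % d + s % d) % d     ≡⟨ cong (λ a → (a + s % d) % d) eq ⟩
  (y % d + s % d) % d     ≡⟨ %-distribˡ-+ y s d ⟨
  (y + s) % d             ∎
  where open ≡-Reasoning

%-cancel-suc : ∀ {d x y} .{{_ : NonZero d}} → suc x % d ≡ suc y % d → x % d ≡ y % d
%-cancel-suc {d} {x} {y} eq = begin
  x % d                 ≡⟨ [m+n]%n≡m%n x d ⟨
  (x + d) % d           ≡⟨ cong (_% d) (shift x) ⟩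
  (suc x + pred d) % d  ≡⟨ %-cong-+ʳ (pred d) eq ⟩
  (suc y + pred d) % d  ≡⟨ cong (_% d) (shift y) ⟨
  (y + d) % d           ≡⟨ [m+n]%n≡m%n y d ⟩
  y % d                 ∎
  where
  open ≡-Reasoning
  shift : ∀ z → z + d ≡ suc z + pred d
  shift z = trans (cong (z +_) (sym (suc-pred d))) (+-suc z (pred d))

%-+-≡⇒≡0 : ∀ {d x e} .{{_ : NonZero d}} → (x + e) % d ≡ x % d → e < d → e ≡ 0
%-+-≡⇒≡0 {d} {x} {e} eq e<d = small-multiple (⌊x+e⌋ ∸ ⌊x⌋) e≡k*d
  where
  open ≡-Reasoning
  ⌊x+e⌋ ⌊x⌋ : ℕ
  ⌊x+e⌋ = (x + e) / d
  ⌊x⌋   = x / d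
  e≡k*d : e ≡ (⌊x+e⌋ ∸ ⌊x⌋) * d
  e≡k*d = begin
    e
      ≡⟨ m+n∸m≡n x e ⟨
    x + e ∸ x
      ≡⟨ cong₂ _∸_ (m≡m%n+[m/n]*n (x + e) d) (m≡m%n+[m/n]*n x d) ⟩
    ((x + e) % d + ⌊x+e⌋ * d) ∸ (x % d + ⌊x⌋ * d)
      ≡⟨ cong (λ a → (a + ⌊x+e⌋ * d) ∸ (x % d + ⌊x⌋ * d)) eq ⟩
    (x % d + ⌊x+e⌋ * d) ∸ (x % d + ⌊x⌋ * d)
      ≡⟨ [m+n]∸[m+o]≡n∸o (x % d) _ _ ⟩
    ⌊x+e⌋ * d ∸ ⌊x⌋ * d
      ≡⟨ *-distribʳ-∸ d ⌊x+e⌋ ⌊x⌋ ⟨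
    (⌊x+e⌋ ∸ ⌊x⌋) * d
      ∎
  small-multiple : ∀ k → e ≡ k * d → e ≡ 0
  small-multiple zero    e≡0 = e≡0
  small-multiple (suc k) e≡ = ⊥-elim (<⇒≱ e<d (subst (d ≤_) (sym e≡) (m≤m+n d (k * d))))

%-window-≤ : ∀ {d i u v} .{{_ : NonZero d}} → u ≤ v → v < d →
             (i + v) % d ≡ (i + u) % d → v ≡ u
%-window-≤ {d} {i} {u} {v} u≤v v<d eq = ≤-antisym (m∸n≡0⇒m≤n v∸u≡0) u≤v
  where
  i+u+[v∸u]≡i+v : i + u + (v ∸ u) ≡ i + v
  i+u+[v∸u]≡i+v = trans (+-assoc i u (v ∸ u)) (cong (i +_) (m+[n∸m]≡n u≤v))
  v∸u≡0 : v ∸ u ≡ 0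
  v∸u≡0 = %-+-≡⇒≡0 (trans (cong (_% d) i+u+[v∸u]≡i+v) eq) (≤-<-trans (m∸n≤m v u) v<d)

%-window-injective : ∀ {d i t t′} .{{_ : NonZero d}} → t < d → t′ < d →
                     (i + t) % d ≡ (i + t′) % d → t ≡ t′
%-window-injective {t = t} {t′} t<d t′<d eq with ≤-total t t′
... | inj₁ t≤t′ = sym (%-window-≤ t≤t′ t′<d (sym eq))
... | inj₂ t′≤t = %-window-≤ t′≤t t<d eq

-- A window of r consecutive residues modulo d ≥ 2r − 1 is determined by its residue set:
-- were the start of the first at offset u > 0 of the second, its last element would be at
-- offset u + r − 1 ≥ r.
window-cover⇒aligned : ∀ {d r′ i j} .{{_ : NonZero d}} → r′ + r′ < d →
  (∀ t → t < suc r′ → ∃[ t′ ] (t′ < suc r′ × (j + t′) % d ≡ (i + t) % d)) →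
  i % d ≡ j % d
window-cover⇒aligned {d} {r′} {i} {j} r′+r′<d cover with cover 0 z<s
... | zero , _ , eq = sym (subst₂ (λ a b → a % d ≡ b % d) (+-identityʳ j) (+-identityʳ i) eq)
... | suc u , s≤s u<r′ , eq with cover r′ ≤-refl
...   | t′ , t′<r , eq′ =
  ⊥-elim (<⇒≱ t′<r (≤-trans (s≤s (m≤n+m r′ u)) (≤-reflexive (sym t′≡))))
  where
  i≡j+1+u : i % d ≡ (j + suc u) % d
  i≡j+1+u = trans (cong (_% d) (sym (+-identityʳ i))) (sym eq)
  t′≡ : t′ ≡ suc u + r′
  t′≡ = %-window-injective (≤-<-trans (≤-trans (s≤s⁻¹ t′<r) (m≤m+n r′ r′)) r′+r′<d)
          (≤-<-trans (+-monoˡ-≤ r′ u<r′) r′+r′<d)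
          (trans eq′ (trans (%-cong-+ʳ r′ i≡j+1+u) (cong (_% d) (+-assoc j (suc u) r′))))

-- Base-q digits, and the digits an arc reads

module Digits (q : ℕ) .{{_ : NonZero q}} where

  digit : ℕ → ℕ → ℕ
  digit zero    x = x % q
  digit (suc j) x = digit j (x / q)

  digit<q : ∀ j x → digit j x < q
  digit<q zero    x = m%n<n x q
  digit<q (suc j) x = digit<q j (x / q)

  /-noCarry : ∀ {x} → suc (x % q) < q → suc x / q ≡ x / q
  /-noCarry {x} lt = proj₂ (%-/-unique lt (cong suc (m≡m%n+[m/n]*n x q)))

  /-carry : ∀ {x} → suc (x % q) ≡ q → suc x / q ≡ suc (x / q)
  /-carry {x} eq = proj₂ (%-/-unique {a = 0} (>-nonZero⁻¹ q)
    (trans (cong suc (m≡m%n+[m/n]*n x q)) (cong (_+ x / q * q) eq)))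

  /-bound : ∀ r {x} → x < q ^ suc r → x / q < q ^ r
  /-bound r {x} x< = m<n*o⇒m/o<n (subst (x <_) (*-comm q (q ^ r)) x<)

  -- Digits of index ≥ j₀ are read off x and those below j₀ off x + 1, as an arc crossing a
  -- block boundary sees them; a carry out of the low digits is detected by digit 0.
  digits-injective : ∀ r j₀ {x y} → j₀ ≤ r → x < q ^ r → y < q ^ r →
    (∀ j → j₀ ≤ j → j < r → digit j x ≡ digit j y) →
    (∀ j → j < j₀ → digit j (suc x) ≡ digit j (suc y)) → x ≡ y
  digits-injective zero _ _ x<1 y<1 _ _ = trans (n<1⇒n≡0 x<1) (sym (n<1⇒n≡0 y<1))
  digits-injective (suc r) zero _ x< y< high _ =
    ≡-by-%-/ (high 0 z≤n z<s)
      (digits-injective r 0 z≤n (/-bound r x<) (/-bound r y<)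
        (λ j _ j<r → high (suc j) z≤n (s<s j<r)) (λ _ ()))
  digits-injective (suc r) (suc j₀) {x} {y} (s≤s j₀≤r) x< y< high low = ≡-by-%-/ x%≡y% x/≡y/
    where
    x%≡y% : x % q ≡ y % q
    x%≡y% = %-cancel-suc (low 0 z<s)
    x/≡y/ : x / q ≡ y / q
    x/≡y/ with suc (x % q) <? q
    ... | yes noCarry = digits-injective r 0 z≤n (/-bound r x<) (/-bound r y<) shared (λ _ ())
      where
      x/q≡ : suc x / q ≡ x / q
      x/q≡ = /-noCarry noCarry
      y/q≡ : suc y / q ≡ y / q
      y/q≡ = /-noCarry (subst (λ a → suc a < q) x%≡y% noCarry)
      shared : ∀ j → 0 ≤ j → j < r → digit j (x / q) ≡ digit j (y / q)
      shared j _ j<r with j <? j₀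
      ... | yes j<j₀ = subst₂ (λ a b → digit j a ≡ digit j b) x/q≡ y/q≡
                                (low (suc j) (s<s j<j₀))
      ... | no j≮j₀  = high (suc j) (s≤s (≮⇒≥ j≮j₀)) (s<s j<r)
    ... | no carry = digits-injective r j₀ j₀≤r (/-bound r x<) (/-bound r y<)
                       (λ j j₀≤j j<r → high (suc j) (s≤s j₀≤j) (s<s j<r))
                       (λ j j<j₀ → subst₂ (λ a b → digit j a ≡ digit j b) x/q≡ y/q≡
                                             (low (suc j) (s<s j<j₀)))
      where
      carries : ∀ {z} → z % q ≡ x % q → suc z / q ≡ suc (z / q)
      carries z%≡ = /-carry (trans (cong suc z%≡) (≤-antisym (m%n<n x q) (≮⇒≥ carry)))
      x/q≡ : suc x / q ≡ suc (x / q)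
      x/q≡ = carries refl
      y/q≡ : suc y / q ≡ suc (y / q)
      y/q≡ = carries (sym x%≡y%)

module BlockDigits (r′ q : ℕ) .{{_ : NonZero q}} where
  open Digits q

  r P : ℕ
  r = suc r′
  P = r + r

  shown : ℕ → ℕ
  shown v = digit (v % P % r) (v / P)

  -- An arc whose first vertex sits at position c of its block shows, at some offset t, the
  -- digit j of the block e places further on.
  Shows : ℕ → ℕ → ℕ → Set
  Shows c e j = ∃[ t ] ∃[ s ] (t < r × s < P × s % r ≡ j × c + t ≡ s + e * P)

  shows-high : ∀ {c j₀ j} → c ≤ r + j₀ → j₀ ≤ j → j < r → Shows c 0 j
  shows-high {c} {j₀} {j} c≤r+j₀ j₀≤j j<r with c ≤? j
  ... | yes c≤j = j ∸ c , j , ≤-<-trans (m∸n≤m j c) j<r , ≤-trans j<r (m≤m+n r r) ,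
                  m<n⇒m%n≡m j<r , trans (m+[n∸m]≡n c≤j) (sym (+-identityʳ j))
  ... | no c≰j  = r + j ∸ c , r + j ,
                  subst (r + j ∸ c <_) (m+n∸n≡m r j) (∸-monoʳ-< (≰⇒> c≰j) c≤r+j) ,
                  +-monoʳ-< r j<r ,
                  trans (cong (_% r) (+-comm r j)) (trans ([m+n]%n≡m%n j r) (m<n⇒m%n≡m j<r)) ,
                  trans (m+[n∸m]≡n c≤r+j) (sym (+-identityʳ (r + j)))
    where
    c≤r+j : c ≤ r + j
    c≤r+j = ≤-trans c≤r+j₀ (+-monoʳ-≤ r j₀≤j)

  shows-low : ∀ {j₀ j} → j < j₀ → j₀ < r → Shows (r + j₀) 1 j
  shows-low {j₀} {j} j<j₀ j₀<r = t , j , t<r , ≤-trans j<r (m≤m+n r r) , m<n⇒m%n≡m j<r , c+t≡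
    where
    j<r : j < r
    j<r = <-trans j<j₀ j₀<r
    t : ℕ
    t = j + r ∸ j₀
    j₀≤j+r : j₀ ≤ j + r
    j₀≤j+r = ≤-trans (<⇒≤ j₀<r) (m≤n+m r j)
    t<r : t < r
    t<r = subst (t <_) (m+n∸m≡n j r) (∸-monoʳ-< j<j₀ j₀≤j+r)
    c+t≡ : r + j₀ + t ≡ j + 1 * P
    c+t≡ = begin
      r + j₀ + t         ≡⟨ +-assoc r j₀ t ⟩
      r + (j₀ + t)       ≡⟨ cong (r +_) (m+[n∸m]≡n j₀≤j+r) ⟩
      r + (j + r)        ≡⟨ rearrange r j ⟩
      j + 1 * P          ∎
      where
      open ≡-Reasoning
      rearrange : ∀ r j → r + (j + r) ≡ j + 1 * (r + r)
      rearrange = solve-∀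

  block-decode : ∀ {c m₁ m₂} → c < P → m₁ < q ^ r → m₂ < q ^ r →
    (∀ {e j} → Shows c e j → digit j (e + m₁) ≡ digit j (e + m₂)) → m₁ ≡ m₂
  block-decode {c} c<P m₁< m₂< agree with c <? r
  ... | yes c<r = digits-injective r 0 z≤n m₁< m₂<
        (λ j _ j<r → agree (shows-high (≤-trans (<⇒≤ c<r) (m≤m+n r 0)) z≤n j<r)) (λ _ ())
  ... | no c≮r with m≤n⇒∃[o]m+o≡n (≮⇒≥ c≮r)
  ...   | j₀ , refl = digits-injective r j₀ (<⇒≤ j₀<r) m₁< m₂<
          (λ j j₀≤j j<r → agree (shows-high ≤-refl j₀≤j j<r))
          (λ j j<j₀ → agree (shows-low j<j₀ j₀<r))
    where
    j₀<r : j₀ < r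
    j₀<r = +-cancelˡ-< r j₀ r c<P

  shown-shift : ∀ {i c m t s e} → i ≡ c + m * P → c + t ≡ s + e * P → s < P →
                shown (i + t) ≡ digit (s % r) (e + m)
  shown-shift {i} {c} {m} {t} {s} {e} refl c+t≡ s<P =
    cong₂ (λ a b → digit (a % r) b) %≡s /≡e+m
    where
    i+t≡ : c + m * P + t ≡ s + (e + m) * P
    i+t≡ = begin
      c + m * P + t      ≡⟨ +-rearrange c (m * P) t ⟩
      c + t + m * P      ≡⟨ cong (_+ m * P) c+t≡ ⟩
      s + e * P + m * P  ≡⟨ regroup s e m P ⟩
      s + (e + m) * P    ∎
      where
      open ≡-Reasoning
      +-rearrange : ∀ a b c → a + b + c ≡ a + c + b
      +-rearrange = solve-∀
      regroup : ∀ s e m P → s + e * P + m * P ≡ s + (e + m) * P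
      regroup = solve-∀
    %≡s : (c + m * P + t) % P ≡ s
    %≡s = proj₁ (%-/-unique {b = e + m} s<P i+t≡)
    /≡e+m : (c + m * P + t) / P ≡ e + m
    /≡e+m = proj₂ (%-/-unique {b = e + m} s<P i+t≡)

  shown-determines-start : ∀ {i₁ i₂} → i₁ < q ^ r → i₂ < q ^ r → i₁ % P ≡ i₂ % P →
    (∀ t → t < r → shown (i₁ + t) ≡ shown (i₂ + t)) → i₁ ≡ i₂
  shown-determines-start {i₁} {i₂} i₁< i₂< aligned same = ≡-by-%-/ aligned
    (block-decode (m%n<n i₁ P) (≤-<-trans (m/n≤m i₁ P) i₁<) (≤-<-trans (m/n≤m i₂ P) i₂<)
                  agree)
    where
    i₁≡ : i₁ ≡ i₁ % P + i₁ / P * P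
    i₁≡ = m≡m%n+[m/n]*n i₁ P
    i₂≡ : i₂ ≡ i₁ % P + i₂ / P * P
    i₂≡ = trans (m≡m%n+[m/n]*n i₂ P) (cong (_+ i₂ / P * P) (sym aligned))
    agree : ∀ {e j} → Shows (i₁ % P) e j → digit j (e + i₁ / P) ≡ digit j (e + i₂ / P)
    agree {e} (t , s , t<r , s<P , refl , c+t≡) = begin
      digit (s % r) (e + i₁ / P)  ≡⟨ shown-shift {m = i₁ / P} {e = e} i₁≡ c+t≡ s<P ⟨
      shown (i₁ + t)              ≡⟨ same t t<r ⟩
      shown (i₂ + t)              ≡⟨ shown-shift {m = i₂ / P} {e = e} i₂≡ c+t≡ s<P ⟩
      digit (s % r) (e + i₂ / P)  ∎
      where open ≡-Reasoning

onArc-noWrap : ∀ {n r} {a v : Fin n} → toℕ a + r ≤ n → OnArc n r a v →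
               ∃[ t ] (t < r × toℕ a + t ≡ toℕ v)
onArc-noWrap fits (t , t<r , inj₁ eq) = t , t<r , eq
onArc-noWrap {n} {a = a} {v} fits (t , t<r , inj₂ eq) =
  ⊥-elim (<⇒≱ (<-≤-trans (+-monoʳ-< (toℕ a) t<r) fits)
              (subst (n ≤_) (sym eq) (m≤n+m n (toℕ v))))

onArc-offset : ∀ {n r t} (a : Fin n) → t < r → (lt : toℕ a + t < n) → OnArc n r a (fromℕ< lt)
onArc-offset {t = t} a t<r lt = t , t<r , inj₁ (sym (toℕ-fromℕ< lt))

onArc-start : ∀ {n r} (a : Fin n) → 0 < r → OnArc n r a a
onArc-start a 0<r = 0 , 0<r , inj₁ (+-identityʳ (toℕ a))

-- Lower bound

module _ {n r k : ℕ} (φ : Fin n → Fin k) where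

  SamePattern : Fin n → Fin n → Set
  SamePattern a a′ = ∀ {t} (lt : toℕ a + t < n) (lt′ : toℕ a′ + t < n) → t < r →
                     φ (fromℕ< lt) ≡ φ (fromℕ< lt′)

  twin : ∀ {a a′ x} → toℕ a + r ≤ n → toℕ a′ + r ≤ n → DisjointArcs n r a a′ →
         SamePattern a a′ → OnArc n r a x → ∃[ y ] (OnArc n r a′ y × y ≢ x × φ y ≡ φ x)
  twin {a} {a′} {x} fits fits′ disjoint same x∈a with onArc-noWrap fits x∈a
  ... | t , t<r , eq = fromℕ< lt′ , y∈a′ ,
                       (λ y≡x → disjoint x x∈a (subst (OnArc n r a′) y≡x y∈a′)) ,
                       trans (sym (same lt lt′ t<r)) (cong φ x≡)
    where
    lt : toℕ a + t < n
    lt = <-≤-trans (+-monoʳ-< (toℕ a) t<r) fits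
    lt′ : toℕ a′ + t < n
    lt′ = <-≤-trans (+-monoʳ-< (toℕ a′) t<r) fits′
    y∈a′ : OnArc n r a′ (fromℕ< lt′)
    y∈a′ = onArc-offset a′ t<r lt′
    x≡ : fromℕ< lt ≡ x
    x≡ = toℕ-injective (trans (toℕ-fromℕ< lt) eq)

  twin-arcs-not-CF : ∀ {a₁ a₂} → 0 < r → toℕ a₁ + r ≤ n → toℕ a₂ + r ≤ n →
                     DisjointArcs n r a₁ a₂ → SamePattern a₁ a₂ → ¬ IsCFColoring (D2 r n) φ
  twin-arcs-not-CF {a₁} {a₂} 0<r fits₁ fits₂ disj same cf
    with cf ((a₁ , a₂) , disj) (a₁ , inj₁ (onArc-start a₁ 0<r))
  ... | x , inj₁ x∈a₁ , unique with twin fits₁ fits₂ disj same x∈a₁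
  ...   | y , y∈a₂ , y≢x , φy≡φx = unique y (inj₂ y∈a₂) y≢x φy≡φx
  twin-arcs-not-CF {a₁} {a₂} 0<r fits₁ fits₂ disj same cf
      | x , inj₂ x∈a₂ , unique
      with twin fits₂ fits₁ (λ v p q → disj v q p) (λ lt lt′ t<r → sym (same lt′ lt t<r)) x∈a₂
  ...   | y , y∈a₁ , y≢x , φy≡φx = unique y (inj₁ y∈a₁) y≢x φy≡φx

module Blocks (r′ n k : ℕ) (room : suc (k ^ suc r′) * suc r′ ≤ n) where

  r K : ℕ
  r = suc r′
  K = k ^ r

  block-fits : (b : Fin (suc K)) → toℕ b * r + r ≤ n
  block-fits b = begin
    toℕ b * r + r   ≡⟨ +-comm (toℕ b * r) r ⟩
    suc (toℕ b) * r ≤⟨ *-monoˡ-≤ r (toℕ<n b) ⟩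
    suc K * r       ≤⟨ room ⟩
    n               ∎
    where open ≤-Reasoning

  blockStart : Fin (suc K) → Fin n
  blockStart b = fromℕ< (<-≤-trans (m<m+n (toℕ b * r) z<s) (block-fits b))

  toℕ-blockStart : ∀ b → toℕ (blockStart b) ≡ toℕ b * r
  toℕ-blockStart b = toℕ-fromℕ< (<-≤-trans (m<m+n (toℕ b * r) z<s) (block-fits b))

  blockStart-fits : ∀ b → toℕ (blockStart b) + r ≤ n
  blockStart-fits b = subst (λ i → i + r ≤ n) (sym (toℕ-blockStart b)) (block-fits b)

  blockStart-disjoint : ∀ {b₁ b₂} → toℕ b₁ < toℕ b₂ →
                        DisjointArcs n r (blockStart b₁) (blockStart b₂)
  blockStart-disjoint {b₁} {b₂} b₁<b₂ v v∈₁ v∈₂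
    with onArc-noWrap (blockStart-fits b₁) v∈₁ | onArc-noWrap (blockStart-fits b₂) v∈₂
  ... | t₁ , t₁<r , eq₁ | t₂ , _ , eq₂ = <-irrefl refl v<v
    where
    open ≤-Reasoning
    v<v : toℕ v < toℕ v
    v<v = begin-strict
      toℕ v                     ≡⟨ eq₁ ⟨
      toℕ (blockStart b₁) + t₁  <⟨ +-monoʳ-< (toℕ (blockStart b₁)) t₁<r ⟩
      toℕ (blockStart b₁) + r   ≡⟨ cong (_+ r) (toℕ-blockStart b₁) ⟩
      toℕ b₁ * r + r            ≡⟨ +-comm (toℕ b₁ * r) r ⟩
      suc (toℕ b₁) * r          ≤⟨ *-monoˡ-≤ r b₁<b₂ ⟩
      toℕ b₂ * r                ≡⟨ toℕ-blockStart b₂ ⟨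
      toℕ (blockStart b₂)       ≤⟨ m≤m+n (toℕ (blockStart b₂)) t₂ ⟩
      toℕ (blockStart b₂) + t₂  ≡⟨ eq₂ ⟩
      toℕ v                     ∎

  module _ (φ : Fin n → Fin k) where

    blockColours : Fin (suc K) → Fin r → Fin k
    blockColours b t =
      φ (fromℕ< (<-≤-trans (+-monoʳ-< (toℕ (blockStart b)) (toℕ<n t)) (blockStart-fits b)))

    blockPattern : Fin (suc K) → Fin K
    blockPattern b = funToFin (blockColours b)

    blockPattern-at : ∀ b {t} (t<r : t < r) (lt : toℕ (blockStart b) + t < n) →
                      φ (fromℕ< lt) ≡ finToFun (blockPattern b) (fromℕ< t<r)
    blockPattern-at b t<r lt = trans
      (cong φ (fromℕ<-cong _ _ (cong (toℕ (blockStart b) +_) (sym (toℕ-fromℕ< t<r))) lt _))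
      (sym (finToFun-funToFin (blockColours b) (fromℕ< t<r)))

    not-CF : ¬ IsCFColoring (D2 r n) φ
    not-CF with pigeonhole (n<1+n K) blockPattern
    ... | b₁ , b₂ , b₁<b₂ , blockPattern≡ =
      twin-arcs-not-CF φ z<s (blockStart-fits b₁) (blockStart-fits b₂)
                       (blockStart-disjoint b₁<b₂) same
      where
      same : SamePattern φ (blockStart b₁) (blockStart b₂)
      same lt₁ lt₂ t<r = trans (blockPattern-at b₁ t<r lt₁)
        (trans (cong (λ p → finToFun p (fromℕ< t<r)) blockPattern≡)
               (sym (blockPattern-at b₂ t<r lt₂)))

colorable⇒n<[1+k^r]*r : ∀ r′ {n k} → CFColorable (D2 (suc r′) n) k →
                        n < suc (k ^ suc r′) * suc r′
colorable⇒n<[1+k^r]*r r′ {n} {k} (φ , cf) with n <? suc (k ^ suc r′) * suc r′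
... | yes n< = n<
... | no n≮ = ⊥-elim (Blocks.not-CF r′ n k (≮⇒≥ n≮) φ cf)

colorable⇒n≤2rk^r : ∀ r′ {n k} → 1 ≤ n → CFColorable (D2 (suc r′) n) k →
                    n ≤ 2 * suc r′ * k ^ suc r′
colorable⇒n≤2rk^r r′ {suc n′} {zero} _ (φ , _) with φ Fin.zero
... | ()
colorable⇒n≤2rk^r r′ {n} {k@(suc _)} _ colorable = begin
  n                     ≤⟨ <⇒≤ (colorable⇒n<[1+k^r]*r r′ colorable) ⟩
  suc K * r             ≤⟨ *-monoˡ-≤ r (+-monoˡ-≤ K (m^n>0 k r)) ⟩
  (K + K) * r           ≡⟨ double K r ⟩
  2 * r * K             ∎
  where
  open ≤-Reasoning
  r K : ℕ
  r = suc r′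
  K = k ^ r
  double : ∀ K r → (K + K) * r ≡ 2 * r * K
  double = solve-∀

-- Upper bound

module UpperColouring (r′ q n : ℕ) .{{_ : NonZero q}} (n≤q^r : n ≤ q ^ suc r′) where
  open Digits q
  open BlockDigits r′ q

  Regular : ℕ → Set
  Regular v = v + P < n

  RegularArc : ℕ → Set
  RegularArc i = Regular (i + r′)

  regularColour : ℕ → ℕ
  regularColour v = shown v + v % P * q

  -- The last P vertices get private colours: no digit argument is needed for an arc that
  -- wraps around or reaches them.
  colour : ℕ → ℕ
  colour v with v + P <? n
  ... | yes _ = regularColour v
  ... | no  _ = P * q + (n ∸ suc v)

  palette : ℕ
  palette = P * q + P

  colour-regular : ∀ {v} → Regular v → colour v ≡ regularColour v
  colour-regular {v} reg with v + P <? n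
  ... | yes _   = refl
  ... | no ¬reg = ⊥-elim (¬reg reg)

  colour-tail : ∀ {v} → ¬ Regular v → colour v ≡ P * q + (n ∸ suc v)
  colour-tail {v} ¬reg with v + P <? n
  ... | yes reg = ⊥-elim (¬reg reg)
  ... | no _    = refl

  regularColour<Pq : ∀ v → regularColour v < P * q
  regularColour<Pq v = begin-strict
    shown v + v % P * q  <⟨ +-monoˡ-< (v % P * q) (digit<q (v % P % r) (v / P)) ⟩
    suc (v % P) * q      ≤⟨ *-monoˡ-≤ q (m%n<n v P) ⟩
    P * q                ∎
    where open ≤-Reasoning

  colour<palette : ∀ {v} → v < n → colour v < palette
  colour<palette {v} v<n with v + P <? n
  ... | yes _   = <-≤-trans (regularColour<Pq v) (m≤m+n (P * q) P)
  ... | no ¬reg = +-monoʳ-< (P * q) (m<n+o⇒m∸n<o n (suc v) (s≤s (≮⇒≥ ¬reg)))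

  regularColour-injective : ∀ {v w} → regularColour v ≡ regularColour w →
                            v % P ≡ w % P × shown v ≡ shown w
  regularColour-injective {v} {w} eq =
    swap (+-*-injective (digit<q (v % P % r) (v / P)) (digit<q (w % P % r) (w / P)) eq)

  tail-colour-private : ∀ {v w} → v < n → w < n → ¬ Regular v → colour w ≡ colour v → w ≡ v
  tail-colour-private {v} {w} v<n w<n ¬reg eq with w + P <? n
  ... | yes _ = ⊥-elim (<⇒≱ (regularColour<Pq w)
                        (≤-trans (m≤m+n (P * q) _) (≤-reflexive (sym (trans eq (colour-tail ¬reg))))))
  ... | no _  = suc-injective
                  (∸-cancelˡ-≡ w<n v<n (+-cancelˡ-≡ (P * q) _ _ (trans eq (colour-tail ¬reg))))

  colour-regular-injective : ∀ {v w} → Regular v → Regular w → colour v ≡ colour w →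
                             v % P ≡ w % P × shown v ≡ shown w
  colour-regular-injective {v} {w} reg-v reg-w eq =
    regularColour-injective {v} {w}
      (trans (sym (colour-regular {v} reg-v)) (trans eq (colour-regular {w} reg-w)))

  <r⇒<P : ∀ {t} → t < r → t < P
  <r⇒<P t<r = ≤-trans t<r (m≤m+n r r)

  regularArc-vertex : ∀ {i t} → RegularArc i → t < r → Regular (i + t)
  regularArc-vertex {i} reg t<r = ≤-<-trans (+-monoˡ-≤ P (+-monoʳ-≤ i (s≤s⁻¹ t<r))) reg

  regularArc-fits : ∀ {i} → RegularArc i → i + r ≤ n
  regularArc-fits {i} reg = subst (_≤ n) (sym (+-suc i r′)) (≤-<-trans (m≤m+n (i + r′) P) reg)

  regularArc-colours-distinct : ∀ {i t t′} → RegularArc i → t < r → t′ < r →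
                                colour (i + t) ≡ colour (i + t′) → t ≡ t′
  regularArc-colours-distinct {i} reg t<r t′<r eq =
    %-window-injective {i = i} (<r⇒<P t<r) (<r⇒<P t′<r)
    (proj₁ (colour-regular-injective (regularArc-vertex {i} reg t<r) (regularArc-vertex {i} reg t′<r) eq))

  Covered : ℕ → ℕ → ℕ → Set
  Covered i₁ i₂ t = ∃[ t′ ] (t′ < r × colour (i₂ + t′) ≡ colour (i₁ + t))

  covered? : ∀ i₁ i₂ t → Dec (Covered i₁ i₂ t)
  covered? i₁ i₂ t = anyUpTo? (λ t′ → colour (i₂ + t′) ≟ colour (i₁ + t)) r

  covered⇒same-start : ∀ {i₁ i₂} → RegularArc i₁ → RegularArc i₂ →
                       (∀ t → t < r → Covered i₁ i₂ t) → i₁ ≡ i₂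
  covered⇒same-start {i₁} {i₂} reg₁ reg₂ cover =
    shown-determines-start (start<q^r (regularArc-fits {i₁} reg₁)) (start<q^r (regularArc-fits {i₂} reg₂))
                           aligned same
    where
    start<q^r : ∀ {i} → i + r ≤ n → i < q ^ r
    start<q^r {i} fits = <-≤-trans (m<m+n i z<s) (≤-trans fits n≤q^r)
    parts : ∀ {t t′} → t < r → t′ < r → colour (i₂ + t′) ≡ colour (i₁ + t) →
            (i₂ + t′) % P ≡ (i₁ + t) % P × shown (i₂ + t′) ≡ shown (i₁ + t)
    parts t<r t′<r =
      colour-regular-injective (regularArc-vertex {i₂} reg₂ t′<r) (regularArc-vertex {i₁} reg₁ t<r)
    aligned : i₁ % P ≡ i₂ % P
    aligned = window-cover⇒aligned {i = i₁} {j = i₂} (s≤s (+-monoʳ-≤ r′ (n≤1+n r′))) λ t t<r →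
      let (t′ , t′<r , eq) = cover t t<r in t′ , t′<r , proj₁ (parts t<r t′<r eq)
    same : ∀ t → t < r → shown (i₁ + t) ≡ shown (i₂ + t)
    same t t<r with cover t t<r
    ... | t′ , t′<r , eq
      with %-window-injective {i = i₂} (<r⇒<P t′<r) (<r⇒<P t<r)
             (trans (proj₁ (parts t<r t′<r eq)) (%-cong-+ʳ {x = i₁} {y = i₂} t aligned))
    ... | refl = sym (proj₂ (parts t<r t′<r eq))

  uncovered-exists : ∀ {i₁ i₂} → RegularArc i₁ → RegularArc i₂ → i₁ ≢ i₂ →
                     ∃[ t ] (t < r × ¬ Covered i₁ i₂ t)
  uncovered-exists {i₁} {i₂} reg₁ reg₂ i₁≢i₂ with anyUpTo? (λ t → ¬? (covered? i₁ i₂ t)) r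
  ... | yes found = found
  ... | no none   = ⊥-elim (i₁≢i₂ (covered⇒same-start {i₁} {i₂} reg₁ reg₂ λ t t<r →
                      decidable-stable (covered? i₁ i₂ t) (λ ¬cov → none (t , t<r , ¬cov))))

  φ : Fin n → Fin palette
  φ v = fromℕ< (colour<palette (toℕ<n v))

  φ-colour : ∀ {x y} → φ y ≡ φ x → colour (toℕ y) ≡ colour (toℕ x)
  φ-colour {x} {y} eq = trans (sym (toℕ-fromℕ< (colour<palette (toℕ<n y))))
                              (trans (cong toℕ eq) (toℕ-fromℕ< (colour<palette (toℕ<n x))))

  Lonely : Edge (D2 r n) → Fin n → Set
  Lonely e x = ∀ y → _∈ₑ_ (D2 r n) y e → y ≢ x → φ y ≢ φ x

  tail-vertex-private : ∀ {x} → ¬ Regular (toℕ x) → ∀ y → y ≢ x → φ y ≢ φ x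
  tail-vertex-private {x} ¬reg y y≢x eq =
    y≢x (toℕ-injective (tail-colour-private (toℕ<n x) (toℕ<n y) ¬reg (φ-colour {x} {y} eq)))

  tail-vertex-on-arc : ∀ a → ¬ RegularArc (toℕ a) → ∃[ x ] (OnArc n r a x × ¬ Regular (toℕ x))
  tail-vertex-on-arc a ¬reg with toℕ a + P <? n
  ... | no ¬reg-a = a , onArc-start a z<s , ¬reg-a
  ... | yes reg-a = fromℕ< last<n , onArc-offset a ≤-refl last<n ,
                    subst (λ v → ¬ Regular v) (sym (toℕ-fromℕ< last<n)) ¬reg
    where
    last<n : toℕ a + r′ < n
    last<n = <-trans (+-monoʳ-< (toℕ a) (<r⇒<P ≤-refl)) reg-a

  regular-arcs-lonely-vertex : ∀ {a₁ a₂} (disj : DisjointArcs n r a₁ a₂) →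
    RegularArc (toℕ a₁) → RegularArc (toℕ a₂) →
    ∃[ x ] (OnArc n r a₁ x × Lonely ((a₁ , a₂) , disj) x)
  regular-arcs-lonely-vertex {a₁} {a₂} disj reg₁ reg₂
    with uncovered-exists {toℕ a₁} {toℕ a₂} reg₁ reg₂ a₁≢a₂
    where
    a₁≢a₂ : toℕ a₁ ≢ toℕ a₂
    a₁≢a₂ eq = disj a₁ (onArc-start a₁ z<s)
                      (subst (OnArc n r a₂) (toℕ-injective (sym eq)) (onArc-start a₂ z<s))
  ... | t , t<r , uncovered = x , onArc-offset a₁ t<r x<n , lonely
    where
    x<n : toℕ a₁ + t < n
    x<n = <-≤-trans (+-monoʳ-< (toℕ a₁) t<r) (regularArc-fits {toℕ a₁} reg₁)
    x : Fin n
    x = fromℕ< x<n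
    colour-y≡ : ∀ {i j y} → i + j ≡ toℕ y → φ y ≡ φ x → colour (i + j) ≡ colour (toℕ a₁ + t)
    colour-y≡ {y = y} i+j≡ eq =
      trans (cong colour i+j≡) (trans (φ-colour {x} {y} eq) (cong colour (toℕ-fromℕ< x<n)))
    lonely : Lonely ((a₁ , a₂) , disj) x
    lonely y (inj₁ y∈a₁) y≢x eq with onArc-noWrap (regularArc-fits {toℕ a₁} reg₁) y∈a₁
    ... | j , j<r , a₁+j≡y
      with regularArc-colours-distinct {toℕ a₁} reg₁ j<r t<r (colour-y≡ {toℕ a₁} {j} a₁+j≡y eq)
    ...   | refl = y≢x (toℕ-injective (trans (sym a₁+j≡y) (sym (toℕ-fromℕ< x<n))))
    lonely y (inj₂ y∈a₂) y≢x eq with onArc-noWrap (regularArc-fits {toℕ a₂} reg₂) y∈a₂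
    ... | j , j<r , a₂+j≡y = uncovered (j , j<r , colour-y≡ {toℕ a₂} {j} a₂+j≡y eq)

  φ-CF : IsCFColoring (D2 r n) φ
  φ-CF ((a₁ , a₂) , disj) _ with toℕ a₁ + r′ + P <? n | toℕ a₂ + r′ + P <? n
  ... | no ¬reg₁ | _ = let (x , x∈a₁ , ¬reg) = tail-vertex-on-arc a₁ ¬reg₁ in
                       x , inj₁ x∈a₁ , λ y _ → tail-vertex-private ¬reg y
  ... | yes _ | no ¬reg₂ = let (x , x∈a₂ , ¬reg) = tail-vertex-on-arc a₂ ¬reg₂ in
                           x , inj₂ x∈a₂ , λ y _ → tail-vertex-private ¬reg y
  ... | yes reg₁ | yes reg₂ =
    let (x , x∈a₁ , lonely) = regular-arcs-lonely-vertex disj reg₁ reg₂ in x , inj₁ x∈a₁ , lonely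

^-distribʳ-* : ∀ a b m → (a * b) ^ m ≡ a ^ m * b ^ m
^-distribʳ-* a b zero    = refl
^-distribʳ-* a b (suc m) = begin
  a * b * (a * b) ^ m      ≡⟨ cong (a * b *_) (^-distribʳ-* a b m) ⟩
  a * b * (a ^ m * b ^ m)  ≡⟨ interchange a b (a ^ m) (b ^ m) ⟩
  a * a ^ m * (b * b ^ m)  ∎
  where
  open ≡-Reasoning
  interchange : ∀ a b x y → a * b * (x * y) ≡ a * x * (b * y)
  interchange = solve-∀

root-bracket : ∀ r′ n → 1 ≤ n → ∃[ p ] (p ^ suc r′ < n × n ≤ suc p ^ suc r′)
root-bracket r′ (suc zero) _ = 0 , z<s , ≤-reflexive (sym (^-zeroˡ (suc r′)))
root-bracket r′ (suc (suc n)) _ with root-bracket r′ (suc n) (s≤s z≤n)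
... | p , p^r<n , n≤[1+p]^r with m≤n⇒m<n∨m≡n n≤[1+p]^r
...   | inj₁ n<[1+p]^r = p , m<n⇒m<1+n p^r<n , n<[1+p]^r
...   | inj₂ n≡[1+p]^r = suc p , subst (_< suc (suc n)) n≡[1+p]^r (n<1+n (suc n)) ,
                         subst (_< suc (suc p) ^ suc r′) (sym n≡[1+p]^r)
                               (^-monoˡ-< (suc r′) (n<1+n (suc p)))

upper-colouring : ∀ r′ {n} → 2 ≤ n →
  ∃[ k ] (k ^ suc r′ ≤ (3 * (suc r′ + suc r′)) ^ suc r′ * n × CFColorable (D2 (suc r′) n) k)
upper-colouring r′ {n} 2≤n with root-bracket r′ n (<⇒≤ 2≤n)
... | zero , _ , n≤1 = ⊥-elim (<⇒≱ 2≤n (subst (n ≤_) (^-zeroˡ (suc r′)) n≤1))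
... | suc p , p^r<n , n≤q^r = palette , palette^r≤ , φ , φ-CF
  where
  open UpperColouring r′ (suc (suc p)) n n≤q^r
  open BlockDigits r′ (suc (suc p)) using (r; P)
  palette≤ : palette ≤ 3 * P * suc p
  palette≤ = subst (palette ≤_) (sym (spread P p)) (m≤m+n palette (P * (p + p)))
    where
    spread : ∀ P p → 3 * P * suc p ≡ P * suc (suc p) + P + P * (p + p)
    spread = solve-∀
  palette^r≤ : palette ^ r ≤ (3 * P) ^ r * n
  palette^r≤ = begin
    palette ^ r                ≤⟨ ^-monoˡ-≤ r palette≤ ⟩
    (3 * P * suc p) ^ r        ≡⟨ ^-distribʳ-* (3 * P) (suc p) r ⟩
    (3 * P) ^ r * suc p ^ r    ≤⟨ *-monoʳ-≤ ((3 * P) ^ r) (<⇒≤ p^r<n) ⟩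
    (3 * P) ^ r * n            ∎
    where open ≤-Reasoning

theorem1p6 : (r : ℕ) → 1 ≤ r →
    ∃[ a ] ∃[ b ] ∃[ N ] ((n : ℕ) → N ≤ n →
      (∃[ k ] (k ^ r ≤ b * n × CFColorable (D2 r n) k))
      × ((k : ℕ) → CFColorable (D2 r n) k → n ≤ a * k ^ r))
theorem1p6 (suc r′) _ = 2 * suc r′ , (3 * (suc r′ + suc r′)) ^ suc r′ , 2 , λ n 2≤n →
  upper-colouring r′ 2≤n , λ k → colorable⇒n≤2rk^r r′ (<⇒≤ 2≤n)
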